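{- Let $d\geq 3$ and $k\geq 1$ be integers, and let $2\leq l\leq d$. For every directed plateau polyhypercube $P$ of dimension $d$ and width $k$, the projection of $P$ on the plane $(\vec{i_1},\vec{i_l})$ is a directed column-convex polyomino of width $k$.
   Context: Work in $\mathbb{Z}^d$ with orthonormal coordinate system $(0,\vec{i_1},\dots,\vec{i_d})$. A cell is a unit hypercube with integer vertices. A polyhypercube of dimension $d$ is a finite union of cells, connected through their $(d-1)$-dimensional faces, defined up to translation. An elementary step is a positive move of one unit along one of the axes $\vec{i_j}$, $1\leq j\leq d$. A polyhypercube is directed if there is a distinguished cell (the root) from which every cell can be reached by a path of cells made only of elementary steps. The width of a polyhypercube is its number of strata, where a stratum is the set of its cells having a given $\vec{i_1}$-coordinate (a polyhypercube of width one). A plateau is a stratum that is a hyperrectangle (box) of cells. A directed plateau polyhypercube is a directed polyhypercube all of whose strata are plateaus. The projection on the plane $(\vec{i_1},\vec{i_l})$ is the polyomino formed by the images of the cells under projection onto the coordinates $(i_1,i_l)$. A polyomino is a finite union of unit squares connected by edges, defined up to translation; its width is its number of columns; it is column-convex if its intersection with each vertical line is connected; it is directed if from a distinguished root cell every cell can be reached by a path using only North (one unit in the first direction) and East (one unit in the second direction) steps. -}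

module Defs where

open import Data.Nat using (ℕ; zero; suc; _≤_; _<_)
open import Data.Integer as ℤ using (ℤ; 0ℤ; 1ℤ; _-_)
  renaming (_+_ to _+ℤ_; _≤_ to _≤ℤ_)
open import Data.Fin using (Fin; fromℕ<; _≟_)
open import Data.Vec using (Vec; []; _∷_; lookup; updateAt)
open import Data.List using (List; []; _∷_; map; length; deduplicate)
open import Data.List.Membership.Propositional using (_∈_)
open import Data.Product using (Σ; _×_; ∃; ∃-syntax)
open import Data.Sum using (_⊎_)
open import Relation.Binary.PropositionalEquality using (_≡_)
open import Function.Bundles using (_⇔_)

-- A cell of ℤ^d is identified with its minimal vertex (a vector of d integers).
-- Coordinate index 0 corresponds to the axis i_1, index j to axis i_{j+1}.
Cell : ℕ → Set
Cell d = Vec ℤ d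

-- A finite union of cells, represented by a list of cells (duplicates irrelevant).
CellSet : ℕ → Set
CellSet d = List (Cell d)

-- i_1-coordinate of a cell (dimension 0 is irrelevant: d ≥ 1 everywhere below)
first : ∀ {d} → Cell d → ℤ
first []      = 0ℤ
first (x ∷ _) = x

Step : ∀ {d} → Cell d → Cell d → Set
Step {d} a b = Σ (Fin d) λ j → b ≡ updateAt a j (_+ℤ 1ℤ)

Adj : ∀ {d} → Cell d → Cell d → Set
Adj a b = Step a b ⊎ Step b a

data PathIn {d} (R : Cell d → Cell d → Set) (S : CellSet d) : Cell d → Cell d → Set where
  here : ∀ {a} → a ∈ S → PathIn R S a a
  next : ∀ {a b c} → a ∈ S → R a b → PathIn R S b c → PathIn R S a c

Polyhypercube : ∀ {d} → CellSet d → Set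
Polyhypercube {d} P = (∃[ c ] c ∈ P) × (∀ {a b} → a ∈ P → b ∈ P → PathIn Adj P a b)

Directed : ∀ {d} → CellSet d → Set
Directed {d} P = Σ (Cell d) λ r → r ∈ P × (∀ {c} → c ∈ P → PathIn Step P r c)

width : ∀ {d} → CellSet d → ℕ
width P = length (deduplicate ℤ._≟_ (map first P))

InBox : ∀ {d} → Cell d → Cell d → Cell d → Set
InBox {d} lo hi e = ∀ (i : Fin d) → (lookup lo i ≤ℤ lookup e i) × (lookup e i ≤ℤ lookup hi i)

AllPlateaus : ∀ {d} → CellSet d → Set
AllPlateaus {d} P =
  ∀ {c} → c ∈ P → Σ (Cell d) λ lo → Σ (Cell d) λ hi →
    ∀ (e : Cell d) → ((e ∈ P × first e ≡ first c) ⇔ InBox lo hi e)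

DirectedPlateauPolyhypercube : ∀ {d} → CellSet d → Set
DirectedPlateauPolyhypercube P = Polyhypercube P × Directed P × AllPlateaus P

-- polyominoes are cells in ℤ^2; coordinate 0 (i_1) indexes the columns
Polyomino : List (Cell 2) → Set
Polyomino = Polyhypercube

ColumnConvex : List (Cell 2) → Set
ColumnConvex Q = ∀ (x y₁ y₂ y : ℤ) → (x ∷ y₁ ∷ []) ∈ Q → (x ∷ y₂ ∷ []) ∈ Q →
  y₁ ≤ℤ y → y ≤ℤ y₂ → (x ∷ y ∷ []) ∈ Q

-- the axis i_l (2 ≤ l ≤ d) as a coordinate index (index l - 1)
axis : ∀ {d} (l : ℕ) → 2 ≤ l → l ≤ d → Fin d
axis (suc l') _ h = fromℕ< {l'} h

project : ∀ {d} → Fin d → CellSet d → List (Cell 2)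
project j P = map (λ c → first c ∷ lookup c j ∷ []) P

-- Projecting onto the plane (i_1, i_l) sends an elementary step either to an
-- elementary step or to a single cell, so paths of cells (face-connecting or
-- directed) project to paths of cells, and the root projects to a root. The
-- first coordinate is untouched, hence the columns of the projection are the
-- strata of P. A column of the projection is the image of one stratum, which
-- is a box, and a box is convex along the i_l axis.
module Submission where

open import Defs
open import Data.Nat using (ℕ; suc; _≤_; s≤s; z≤n)
open import Data.Product using (_×_; _,_; proj₁; proj₂)
open import Data.Sum using (_⊎_; inj₁; inj₂)
open import Data.Integer as ℤ using (ℤ) renaming (_≤_ to _≤ℤ_)
import Data.Integer.Properties as ℤ
open import Data.Fin using (Fin; zero; suc; fromℕ<) renaming (_≟_ to _≟ᶠ_)
open import Data.Vec using ([]; _∷_; lookup; updateAt)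
open import Data.Vec.Properties using (∷-injective; lookup∘updateAt; lookup∘updateAt′)
open import Data.List using (map; length; deduplicate)
open import Data.List.Properties using (map-∘)
open import Data.List.Membership.Propositional using (_∈_)
open import Data.List.Membership.Propositional.Properties using (∈-map⁺; ∈-map⁻)
open import Function using (const)
open import Function.Bundles using (Equivalence)
open import Relation.Binary.PropositionalEquality
open import Relation.Nullary using (yes; no)

WeaklyPreserves : ∀ {m n} → (Cell m → Cell n) →
  (Cell m → Cell m → Set) → (Cell n → Cell n → Set) → Set
WeaklyPreserves f R R′ = ∀ {a b} → R a b → f a ≡ f b ⊎ R′ (f a) (f b)

module _ {m n} {f : Cell m → Cell n} where

  map-PathIn : ∀ {R R′} → WeaklyPreserves f R R′ →
    ∀ {P a c} → PathIn R P a c → PathIn R′ (map f P) (f a) (f c)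
  map-PathIn pres (here a∈P) = here (∈-map⁺ f a∈P)
  map-PathIn {R′ = R′} pres {P} {c = c} (next a∈P r path) with pres r
  ... | inj₁ fa≡fb = subst (λ x → PathIn R′ (map f P) x (f c)) (sym fa≡fb) (map-PathIn pres path)
  ... | inj₂ r′    = next (∈-map⁺ f a∈P) r′ (map-PathIn pres path)

  module _ (pres : WeaklyPreserves f Step Step) where

    weaklyPreserves-Adj : WeaklyPreserves f Adj Adj
    weaklyPreserves-Adj (inj₁ s) with pres s
    ... | inj₁ fa≡fb = inj₁ fa≡fb
    ... | inj₂ s′    = inj₂ (inj₁ s′)
    weaklyPreserves-Adj (inj₂ s) with pres s
    ... | inj₁ fb≡fa = inj₁ (sym fb≡fa)
    ... | inj₂ s′    = inj₂ (inj₂ s′)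

    map-Polyhypercube : ∀ {P} → Polyhypercube P → Polyhypercube (map f P)
    map-Polyhypercube {P} ((c , c∈P) , connected) = (f c , ∈-map⁺ f c∈P) , connected′
      where
      connected′ : ∀ {a b} → a ∈ map f P → b ∈ map f P → PathIn Adj (map f P) a b
      connected′ a∈ b∈ with ∈-map⁻ f a∈ | ∈-map⁻ f b∈
      ... | _ , a∈P , refl | _ , b∈P , refl =
        map-PathIn weaklyPreserves-Adj (connected a∈P b∈P)

    map-Directed : ∀ {P} → Directed P → Directed (map f P)
    map-Directed {P} (r , r∈P , reach) = f r , ∈-map⁺ f r∈P , reach′
      where
      reach′ : ∀ {c} → c ∈ map f P → PathIn Step (map f P) (f r) c
      reach′ c∈ with ∈-map⁻ f c∈
      ... | _ , c∈P , refl = map-PathIn pres (reach c∈P)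

InBox-updateAt : ∀ {d} (lo hi a : Cell d) {y : ℤ} (i : Fin d) → InBox lo hi a →
  lookup lo i ≤ℤ y → y ≤ℤ lookup hi i → InBox lo hi (updateAt a i (const y))
InBox-updateAt lo hi a {y} i a∈box lo≤y y≤hi k with k ≟ᶠ i
... | yes refl rewrite lookup∘updateAt i {const y} a = lo≤y , y≤hi
... | no k≢i   rewrite lookup∘updateAt′ k i {const y} k≢i a = a∈box k

module _ {n} (j : Fin n) where

  -- index suc j is the axis i_{j+2}, so the axis i_1 is never projected away
  planeProjection : Cell (suc n) → Cell 2
  planeProjection c = first c ∷ lookup c (suc j) ∷ []

  planeProjection-step : WeaklyPreserves planeProjection Step Step
  planeProjection-step {a₀ ∷ a} (zero , refl) = inj₂ (zero , refl)
  planeProjection-step {a₀ ∷ a} (suc i , refl) with i ≟ᶠ j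
  ... | yes refl = inj₂ (suc zero , cong (λ y → a₀ ∷ y ∷ []) (lookup∘updateAt i a))
  ... | no i≢j   = inj₁ (cong (λ y → a₀ ∷ y ∷ [])
                           (sym (lookup∘updateAt′ j i (λ j≡i → i≢j (sym j≡i)) a)))

  width-planeProjection : (P : CellSet (suc n)) → width (map planeProjection P) ≡ width P
  width-planeProjection P = cong (λ xs → length (deduplicate ℤ._≟_ xs)) (sym (map-∘ P))

  AllPlateaus⇒ColumnConvex : {P : CellSet (suc n)} → AllPlateaus P →
    ColumnConvex (map planeProjection P)
  AllPlateaus⇒ColumnConvex {P} plateaus x y₁ y₂ y p₁∈ p₂∈ y₁≤y y≤y₂
    with ∈-map⁻ planeProjection p₁∈ | ∈-map⁻ planeProjection p₂∈
  ... | e₁ , e₁∈P , p₁≡ | e₂ , e₂∈P , p₂≡ with plateaus e₁∈P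
  ... | lo , hi , stratum = subst (_∈ map planeProjection P) projects-to (∈-map⁺ planeProjection e∈P)
    where
    open Equivalence
    x≡₁ = ∷-injective p₁≡ .proj₁
    y₁≡ = ∷-injective (∷-injective p₁≡ .proj₂) .proj₁
    x≡₂ = ∷-injective p₂≡ .proj₁
    y₂≡ = ∷-injective (∷-injective p₂≡ .proj₂) .proj₁
    e₁∈box = to (stratum e₁) (e₁∈P , refl)
    e₂∈box = to (stratum e₂) (e₂∈P , trans (sym x≡₂) x≡₁)
    e = updateAt e₁ (suc j) (const y)
    e∈box : InBox lo hi e
    e∈box = InBox-updateAt lo hi e₁ (suc j) e₁∈box
        (ℤ.≤-trans (e₁∈box (suc j) .proj₁) (subst (_≤ℤ y) y₁≡ y₁≤y))
        (ℤ.≤-trans (subst (y ≤ℤ_) y₂≡ y≤y₂) (e₂∈box (suc j) .proj₂))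
    e∈stratum = from (stratum e) e∈box
    e∈P = e∈stratum .proj₁
    projects-to : planeProjection e ≡ x ∷ y ∷ []
    projects-to = cong₂ (λ u v → u ∷ v ∷ [])
      (trans (e∈stratum .proj₂) (sym x≡₁)) (lookup∘updateAt (suc j) e₁)

theorem1 : (d k l : ℕ) → 3 ≤ d → 1 ≤ k → (h2 : 2 ≤ l) → (hd : l ≤ d) →
    (P : CellSet d) → DirectedPlateauPolyhypercube P → width P ≡ k →
    Polyomino (project (axis l h2 hd) P) × Directed (project (axis l h2 hd) P) ×
    ColumnConvex (project (axis l h2 hd) P) × width (project (axis l h2 hd) P) ≡ k
theorem1 (suc d) k (suc (suc l)) _ _ (s≤s (s≤s z≤n)) (s≤s hd) P
         (polyhypercube , directed , plateaus) width≡k =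
    map-Polyhypercube (planeProjection-step j) polyhypercube
  , map-Directed (planeProjection-step j) directed
  , AllPlateaus⇒ColumnConvex j plateaus
  , trans (width-planeProjection j P) width≡k
  where
  j = fromℕ< hd
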